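{- Let $q$ be a power of an odd prime, let $\lambda\in\mathbb{F}_q$ be a non-square, and let $a\in\mathbb{F}_q^*$. Then the graph $\mathcal{G}(\lambda,X+a)$ has no (weakly) connected component with exactly four vertices.
   Context: For a polynomial $f\in\mathbb{F}_q[X]$ and a non-square $\lambda\in\mathbb{F}_q$, $\mathcal{G}(\lambda,f)$ is the directed graph with vertex set $\mathbb{F}_q$ and an edge from $x$ to $y$ iff $(y^2-f(x))(\lambda y^2-f(x))=0$ (loops allowed). -}

module Defs where

open import Level using (0ℓ)
open import Data.Nat using (ℕ; _^_; _≤_)
open import Data.Nat.Primality using (Prime)
open import Data.Fin using (Fin)
open import Data.Product using (∃; Σ; _×_; _,_)
open import Data.Sum using (_⊎_)
open import Relation.Nullary using (¬_)
open import Relation.Binary.PropositionalEquality using (_≡_; _≢_)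
open import Function.Bundles using (_↔_)
open import Algebra.Bundles using (CommutativeRing)
open import Relation.Binary.Construct.Closure.Symmetric using (SymClosure)
open import Relation.Binary.Construct.Closure.ReflexiveTransitive using (Star)

record FiniteField : Set₁ where
  field
    commRing : CommutativeRing 0ℓ 0ℓ
  open CommutativeRing commRing public
  field
    ≈⇒≡     : ∀ {x y} → x ≈ y → x ≡ y
    0≢1     : 0# ≢ 1#
    inverse : ∀ x → x ≢ 0# → ∃ λ y → x * y ≡ 1#
    size    : ℕ
    enum    : Carrier ↔ Fin size

module _ (F : FiniteField) where
  open FiniteField F

  IsSquare : Carrier → Set
  IsSquare x = ∃ λ y → y * y ≡ x

  linPoly : Carrier → Carrier → Carrier
  linPoly a x = x + a

  Edge : Carrier → (Carrier → Carrier) → Carrier → Carrier → Set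
  Edge λ' f x y = ((y * y) - f x) * ((λ' * (y * y)) - f x) ≡ 0#

  WConn : Carrier → (Carrier → Carrier) → Carrier → Carrier → Set
  WConn λ' f = Star (SymClosure (Edge λ' f))

  HasComponentOfSize4 : Carrier → (Carrier → Carrier) → Set
  HasComponentOfSize4 λ' f =
    Σ Carrier λ v₁ → Σ Carrier λ v₂ → Σ Carrier λ v₃ → Σ Carrier λ v₄ →
      (v₁ ≢ v₂) × (v₁ ≢ v₃) × (v₁ ≢ v₄) × (v₂ ≢ v₃) × (v₂ ≢ v₄) × (v₃ ≢ v₄) ×
      WConn λ' f v₁ v₂ × WConn λ' f v₁ v₃ × WConn λ' f v₁ v₄ ×
      (∀ w → WConn λ' f v₁ w → (w ≡ v₁) ⊎ (w ≡ v₂) ⊎ (w ≡ v₃) ⊎ (w ≡ v₄))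

module Submission where

-- The in-neighbours of y in G(λ, X + a) are y² − a and λy² − a; for y ≠ 0 they are distinct and
-- each has exactly ±y as out-neighbours. So a component C is closed under negation and under
-- in-neighbours, and if |C| = 4 then 0 ∉ C (otherwise 0, ±a and some ±z are five vertices of C).
-- Take u ∈ C, A = u² − a and B = λu² − a. If B = −A, then either {A, B} = {±u}, which makes ±u a
-- component of size 2, or C = {±u, ±A} and the in-neighbours of Y = A are ±u. If B ≠ −A, then
-- C = {±A, ±B} and the element Y of {A, B} with Y ≠ ±u has in-neighbours −A and −B. Either way the
-- in-neighbour relations are linear equations in u² and Y² with coefficients 1 and λ, which force
-- λ = 1 or Y² = u².

open import Defs
open import Level using (Level)
open import Data.Nat using (ℕ; _≤_; _<_; _^_)
open import Data.Nat.Primality using (Prime)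
open import Data.Nat.Properties using (<⇒≱; n<1+n; _≤?_)
open import Data.Empty using (⊥)
open import Data.Fin as Fin using (Fin)
open import Data.Fin.Properties using (injective⇒≤)
open import Data.Product as Product using (∃; _×_; _,_)
open import Data.Sum as Sum using (_⊎_; inj₁; inj₂; [_,_]′; swap)
open import Data.Unit using (⊤; tt)
open import Data.Vec using (Vec; []; _∷_; lookup; tabulate; map)
open import Data.Vec.Relation.Unary.All as All using (All; []; _∷_; decide; lookupAny; universal)
open import Data.Vec.Relation.Unary.All.Properties using (lookup⁺)
open import Data.Vec.Relation.Unary.Any as Any using (here; there)
open import Data.Vec.Relation.Unary.Any.Properties using (lookup-index; map⁻)
open import Data.Vec.Relation.Unary.AllPairs using ([]; _∷_)
open import Data.Vec.Relation.Unary.Unique.Propositional using (Unique)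
open import Data.Vec.Relation.Unary.Unique.Propositional.Properties using (lookup-injective; tabulate⁺; map⁺)
open import Data.Vec.Membership.Propositional using (_∈_)
open import Data.Vec.Membership.Propositional.Properties using (∈-tabulate⁺)
open import Function using (id; _∘_; flip)
open import Function.Bundles using (Inverse; Injection)
open import Function.Properties.Inverse using (↔⇒↣; ↔-sym)
open import Relation.Binary.Definitions using (DecidableEquality)
open import Relation.Binary.PropositionalEquality
  using (_≡_; _≢_; refl; sym; trans; cong; subst; ≢-sym; module ≡-Reasoning)
open import Relation.Nullary using (¬_; yes; no; contradiction; toSum)
open import Relation.Nullary.Decidable using (via-injection; from-no)
open import Relation.Unary using (Pred)
open import Relation.Binary.Core using (Rel)
open import Relation.Binary.Construct.Closure.Symmetric using (SymClosure; fwd; bwd)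
open import Relation.Binary.Construct.Closure.ReflexiveTransitive as Star using (Star; ε; _◅_; _◅◅_)
import Algebra.Properties.Ring
import Algebra.Properties.CommutativeSemigroup
import Algebra.Solver.Ring.NaturalCoefficients.Default

private variable
  ℓ ℓ′ : Level
  T : Set ℓ
  m n : ℕ

unique⊆⇒length≤ : {xs : Vec T m} {ys : Vec T n} → Unique xs → All (_∈ ys) xs → m ≤ n
unique⊆⇒length≤ {xs = xs} {ys} xs-unique xs⊆ys = injective⇒≤ position-injective
  where
  position : Fin _ → Fin _
  position i = Any.index (lookup⁺ xs⊆ys i)

  position-injective : ∀ {i j} → position i ≡ position j → i ≡ j
  position-injective {i} {j} eq = lookup-injective xs-unique i j (begin
    lookup xs i             ≡⟨ lookup-index (lookup⁺ xs⊆ys i) ⟩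
    lookup ys (position i)  ≡⟨ cong (lookup ys) eq ⟩
    lookup ys (position j)  ≡⟨ lookup-index (lookup⁺ xs⊆ys j) ⟨
    lookup xs j             ∎)
    where open ≡-Reasoning

module _ (_≟_ : DecidableEquality T) where

  all≢⊎∈ : ∀ z (ys : Vec T n) → All (z ≢_) ys ⊎ z ∈ ys
  all≢⊎∈ z = decide (λ y → swap (toSum (z ≟ y)))

  unique⇒exhaustive : {P : Pred T ℓ′} {vs : Vec T n} → (∀ {w} → P w → w ∈ vs) →
                      {xs : Vec T n} → Unique xs → All P xs → ∀ {w} → P w → w ∈ xs
  unique⇒exhaustive P⊆vs {xs} xs-unique xs⊆P {w} w∈P with all≢⊎∈ w xs
  ... | inj₂ w∈xs = w∈xs
  ... | inj₁ w∉xs = contradiction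
        (unique⊆⇒length≤ (w∉xs ∷ xs-unique) (All.map P⊆vs (w∈P ∷ xs⊆P)))
        (<⇒≱ (n<1+n _))

  ∃-outside : {P : Pred T ℓ′} {vs : Vec T n} → Unique vs → All P vs →
              (ys : Vec T m) → m < n → ∃ λ z → P z × All (z ≢_) ys
  ∃-outside {vs = vs} vs-unique vs⊆P ys m<n with decide (λ v → swap (all≢⊎∈ v ys)) vs
  ... | inj₁ vs⊆ys = contradiction (unique⊆⇒length≤ vs-unique vs⊆ys) (<⇒≱ m<n)
  ... | inj₂ some∉ys = Any.lookup some∉ys , lookupAny vs⊆P some∉ys

distinct-pair : ∀ {x y p q : T} → x ≡ p ⊎ x ≡ q → y ≡ p ⊎ y ≡ q → x ≢ y →
                (x ≡ p × y ≡ q) ⊎ (x ≡ q × y ≡ p)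
distinct-pair (inj₁ x≡p) (inj₂ y≡q) _   = inj₁ (x≡p , y≡q)
distinct-pair (inj₂ x≡q) (inj₁ y≡p) _   = inj₂ (x≡q , y≡p)
distinct-pair (inj₁ x≡p) (inj₁ y≡p) x≢y = contradiction (trans x≡p (sym y≡p)) x≢y
distinct-pair (inj₂ x≡q) (inj₂ y≡q) x≢y = contradiction (trans x≡q (sym y≡q)) x≢y

Star-SymClosure-invariant : ∀ {r} {R : Rel T r} {P : Pred T ℓ′} →
  (∀ {x y} → R x y → P x → P y) → (∀ {x y} → R x y → P y → P x) →
  ∀ {x y} → Star (SymClosure R) x y → P x → P y
Star-SymClosure-invariant {R = R} {P} forward backward = Star.fold (λ x y → P x → P y) step id
  where
  step : ∀ {x y z} → SymClosure R x y → (P y → P z) → P x → P z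
  step (fwd r) k = k ∘ forward r
  step (bwd r) k = k ∘ backward r

module FieldProperties (F : FiniteField) where
  open FiniteField F
    renaming (refl to ≈-refl; sym to ≈-sym; trans to ≈-trans; reflexive to ≈-reflexive)
  private module R = Algebra.Properties.Ring ring
  open Algebra.Solver.Ring.NaturalCoefficients.Default commutativeSemiring using (solve; _:=_; _:+_; _:*_; con)
  open ≡-Reasoning

  infix 4 _≟_
  _≟_ : DecidableEquality Carrier
  _≟_ = via-injection (↔⇒↣ enum) Fin._≟_

  x-y≡0⇒x≡y : ∀ {x y} → x - y ≡ 0# → x ≡ y
  x-y≡0⇒x≡y {x} {y} e = ≈⇒≡ (R.x∙y⁻¹≈ε⇒x≈y x y (≈-reflexive e))

  x+y≡0⇒y≡-x : ∀ {x y} → x + y ≡ 0# → y ≡ - x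
  x+y≡0⇒y≡-x {x} {y} e = ≈⇒≡ (R.+-inverseʳ-unique x y (≈-reflexive e))

  -‿involutive : ∀ x → - - x ≡ x
  -‿involutive x = ≈⇒≡ (R.-‿involutive x)

  x≡-y⇒y≡-x : ∀ {x y} → x ≡ - y → y ≡ - x
  x≡-y⇒y≡-x {x} {y} refl = sym (-‿involutive y)

  -x≡-y⇒x≡y : ∀ {x y} → - x ≡ - y → x ≡ y
  -x≡-y⇒x≡y -x≡-y = ≈⇒≡ (R.-‿injective (≈-reflexive -x≡-y))

  -x≡0⇒x≡0 : ∀ {x} → - x ≡ 0# → x ≡ 0#
  -x≡0⇒x≡0 -x≡0 = -x≡-y⇒x≡y (trans -x≡0 (≈⇒≡ (≈-sym R.-0#≈0#)))

  infix 4 _≡±_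
  _≡±_ : Carrier → Carrier → Set
  x ≡± y = x ≡ y ⊎ x ≡ - y

  ≡±-sym : ∀ {x y} → x ≡± y → y ≡± x
  ≡±-sym = Sum.map sym x≡-y⇒y≡-x

  ≡±-trans : ∀ {x y z} → x ≡± y → y ≡± z → x ≡± z
  ≡±-trans (inj₁ refl) y≡±z        = y≡±z
  ≡±-trans (inj₂ refl) (inj₁ refl) = inj₂ refl
  ≡±-trans (inj₂ refl) (inj₂ refl) = inj₁ (-‿involutive _)

  x*y≡0⇒x≡0⊎y≡0 : ∀ {x y} → x * y ≡ 0# → x ≡ 0# ⊎ y ≡ 0#
  x*y≡0⇒x≡0⊎y≡0 {x} {y} xy≡0 with x ≟ 0#
  ... | yes x≡0 = inj₁ x≡0
  ... | no x≢0 with x⁻¹ , xx⁻¹≡1 ← inverse x x≢0 = inj₂ (begin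
    y                ≡⟨ ≈⇒≡ (≈-sym (*-identityˡ y)) ⟩
    1# * y           ≡⟨ cong (_* y) (sym xx⁻¹≡1) ⟩
    (x * x⁻¹) * y    ≡⟨ ≈⇒≡ (≈-trans (*-congʳ (*-comm x x⁻¹)) (*-assoc x⁻¹ x y)) ⟩
    x⁻¹ * (x * y)    ≡⟨ cong (x⁻¹ *_) xy≡0 ⟩
    x⁻¹ * 0#         ≡⟨ ≈⇒≡ (zeroʳ x⁻¹) ⟩
    0#               ∎)

  x≡y⇒x-y≡0 : ∀ {x y} → x ≡ y → x - y ≡ 0#
  x≡y⇒x-y≡0 {x} refl = ≈⇒≡ (-‿inverseʳ x)

  x+y≡z⇒x≡z-y : ∀ {x y z} → x + y ≡ z → x ≡ z - y
  x+y≡z⇒x≡z-y {x} {y} refl = ≈⇒≡ (≈-sym (R.//-rightDividesʳ y x))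

  x-y+y≡x : ∀ x y → (x - y) + y ≡ x
  x-y+y≡x x y = ≈⇒≡ (R.//-rightDividesˡ y x)

  -x*-x≡x*x : ∀ x → - x * - x ≡ x * x
  -x*-x≡x*x x = begin
    - x * - x      ≡⟨ ≈⇒≡ (≈-sym (R.-‿distribˡ-* x (- x))) ⟩
    - (x * - x)    ≡⟨ cong -_ (≈⇒≡ (≈-sym (R.-‿distribʳ-* x x))) ⟩
    - - (x * x)    ≡⟨ -‿involutive (x * x) ⟩
    x * x          ∎

  [x-y][x+y]≡x*x-y*y : ∀ x y → (x - y) * (x + y) ≡ x * x - y * y
  [x-y][x+y]≡x*x-y*y x y = begin
    (x - y) * (x + y)
      ≡⟨ ≈⇒≡ (solve 3 (λ x y -y → (x :+ -y) :* (x :+ y) := x :* x :+ -y :* y :+ (-y :+ y) :* x) ≈-refl x y (- y)) ⟩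
    x * x + - y * y + (- y + y) * x ≡⟨ cong (λ t → x * x + - y * y + t * x) (≈⇒≡ (-‿inverseˡ y)) ⟩
    x * x + - y * y + 0# * x        ≡⟨ ≈⇒≡ (≈-trans (+-congˡ (zeroˡ x)) (+-identityʳ _)) ⟩
    x * x + - y * y                 ≡⟨ cong (x * x +_) (≈⇒≡ (≈-sym (R.-‿distribˡ-* y y))) ⟩
    x * x - y * y                   ∎

  *-cancelˡ-≢0 : ∀ {c x y} → c ≢ 0# → c * x ≡ c * y → x ≡ y
  *-cancelˡ-≢0 {c} {x} {y} c≢0 cx≡cy with x*y≡0⇒x≡0⊎y≡0 (trans (≈⇒≡ (R.x[y-z]≈xy-xz c x y)) (x≡y⇒x-y≡0 cx≡cy))
  ... | inj₁ c≡0   = contradiction c≡0 c≢0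
  ... | inj₂ x-y≡0 = x-y≡0⇒x≡y x-y≡0

  x*x≡y*y⇒x≡±y : ∀ {x y} → x * x ≡ y * y → x ≡± y
  x*x≡y*y⇒x≡±y {x} {y} xx≡yy with x*y≡0⇒x≡0⊎y≡0 (trans ([x-y][x+y]≡x*x-y*y x y) (x≡y⇒x-y≡0 xx≡yy))
  ... | inj₁ x-y≡0 = inj₁ (x-y≡0⇒x≡y x-y≡0)
  ... | inj₂ x+y≡0 = inj₂ (x≡-y⇒y≡-x (x+y≡0⇒y≡-x x+y≡0))

  *-cancelʳ-≢0 : ∀ {c x y} → c ≢ 0# → x * c ≡ y * c → x ≡ y
  *-cancelʳ-≢0 {c} {x} {y} c≢0 xc≡yc =
    *-cancelˡ-≢0 c≢0 (trans (≈⇒≡ (*-comm c x)) (trans xc≡yc (≈⇒≡ (*-comm y c))))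

  x+cy≡cx+y⇒x≡y : ∀ {c x y} → c ≢ 1# → x + c * y ≡ c * x + y → x ≡ y
  x+cy≡cx+y⇒x≡y {c} {x} {y} c≢1 e with (x - y) ≟ 0#
  ... | yes x-y≡0 = x-y≡0⇒x≡y x-y≡0
  ... | no  x-y≢0 =
    contradiction (*-cancelʳ-≢0 x-y≢0 (trans (≈⇒≡ (*-identityˡ (x - y))) x-y≡c[x-y])) (≢-sym c≢1)
    where
    x-y≡c[x-y] : x - y ≡ c * (x - y)
    x-y≡c[x-y] = ≈⇒≡ (R.+-cancelʳ (y + c * y) _ _ (≈-reflexive (begin
      (x - y) + (y + c * y)   ≡⟨ ≈⇒≡ (≈-sym (+-assoc (x - y) y (c * y))) ⟩
      (x - y) + y + c * y     ≡⟨ cong (_+ c * y) (x-y+y≡x x y) ⟩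
      x + c * y               ≡⟨ e ⟩
      c * x + y               ≡⟨ cong (λ t → c * t + y) (sym (x-y+y≡x x y)) ⟩
      c * ((x - y) + y) + y
        ≡⟨ ≈⇒≡ (solve 3 (λ c d y → c :* (d :+ y) :+ y := c :* d :+ (y :+ c :* y)) ≈-refl c (x - y) y) ⟩
      c * (x - y) + (y + c * y) ∎)))

  x+cx≡y+cy⇒x≡y : ∀ {c x y} → x + c * x ≢ 0# → x + c * x ≡ y + c * y → x ≡ y
  x+cx≡y+cy⇒x≡y {c} {x} {y} x+cx≢0 e = *-cancelˡ-≢0 1+c≢0 (begin
    (1# + c) * x   ≡⟨ [1+c]z≡z+cz x ⟩
    x + c * x      ≡⟨ e ⟩
    y + c * y      ≡⟨ sym ([1+c]z≡z+cz y) ⟩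
    (1# + c) * y   ∎)
    where
    [1+c]z≡z+cz : ∀ z → (1# + c) * z ≡ z + c * z
    [1+c]z≡z+cz z = ≈⇒≡ (solve 2 (λ c z → (con 1 :+ c) :* z := z :+ c :* z) ≈-refl c z)

    1+c≢0 : 1# + c ≢ 0#
    1+c≢0 1+c≡0 = x+cx≢0 (begin
      x + c * x      ≡⟨ sym ([1+c]z≡z+cz x) ⟩
      (1# + c) * x   ≡⟨ cong (_* x) 1+c≡0 ⟩
      0# * x         ≡⟨ ≈⇒≡ (zeroˡ x) ⟩
      0#             ∎)

  elements : Vec Carrier size
  elements = tabulate (Inverse.from enum)

  ∈-elements : ∀ x → x ∈ elements
  ∈-elements x = subst (_∈ elements) (Inverse.strictlyInverseʳ enum x)
                       (∈-tabulate⁺ (Inverse.from enum) (Inverse.to enum x))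

  elements-unique : Unique elements
  elements-unique = tabulate⁺ (Injection.injective (↔⇒↣ (↔-sym enum)))

  [1+1]x≡x+x : ∀ x → (1# + 1#) * x ≡ x + x
  [1+1]x≡x+x x = ≈⇒≡ (solve 1 (λ x → (con 1 :+ con 1) :* x := x :+ x) ≈-refl x)

  -- In characteristic 2 squaring is injective, hence onto by finiteness.
  nonsquare⇒1+1≢0 : ∀ {c} → ¬ IsSquare F c → 1# + 1# ≢ 0#
  nonsquare⇒1+1≢0 {c} c-nonsquare 1+1≡0 = c-nonsquare (Product.map₂ sym (Any.satisfied (map⁻ c∈squares)))
    where
    x≡-x : ∀ x → x ≡ - x
    x≡-x x = x+y≡0⇒y≡-x (trans (sym ([1+1]x≡x+x x)) (trans (cong (_* x) 1+1≡0) (≈⇒≡ (zeroˡ x))))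

    square-injective : ∀ {x y} → x * x ≡ y * y → x ≡ y
    square-injective xx≡yy = [ id , (λ x≡-y → trans x≡-y (sym (x≡-x _))) ]′ (x*x≡y*y⇒x≡±y xx≡yy)

    c∈squares : c ∈ map (λ x → x * x) elements
    c∈squares = unique⇒exhaustive _≟_ {P = λ _ → ⊤} (λ {w} _ → ∈-elements w)
                  (map⁺ square-injective elements-unique) (universal (λ _ → tt) _) tt

  module _ (1+1≢0 : 1# + 1# ≢ 0#) where

    x+x≡0⇒x≡0 : ∀ {x} → x + x ≡ 0# → x ≡ 0#
    x+x≡0⇒x≡0 {x} x+x≡0 with x*y≡0⇒x≡0⊎y≡0 (trans ([1+1]x≡x+x x) x+x≡0)
    ... | inj₁ 1+1≡0 = contradiction 1+1≡0 1+1≢0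
    ... | inj₂ x≡0   = x≡0

    x≢0⇒x≢-x : ∀ {x} → x ≢ 0# → x ≢ - x
    x≢0⇒x≢-x {x} x≢0 x≡-x = x≢0 (x+x≡0⇒x≡0 (trans (cong (x +_) x≡-x) (≈⇒≡ (-‿inverseʳ x))))

  module _ {c} (c-nonsquare : ¬ IsSquare F c) where

    nonsquare⇒≢0 : c ≢ 0#
    nonsquare⇒≢0 c≡0 = c-nonsquare (0# , trans (≈⇒≡ (zeroˡ 0#)) (sym c≡0))

    nonsquare⇒≢1 : c ≢ 1#
    nonsquare⇒≢1 c≡1 = c-nonsquare (1# , trans (≈⇒≡ (*-identityˡ 1#)) (sym c≡1))

    x*x≡c[y*y]⇒x≡0×y≡0 : ∀ {x y} → x * x ≡ c * (y * y) → x ≡ 0# × y ≡ 0#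
    x*x≡c[y*y]⇒x≡0×y≡0 {x} {y} xx≡cyy with y ≟ 0#
    ... | no y≢0 with y⁻¹ , yy⁻¹≡1 ← inverse y y≢0 = contradiction (x * y⁻¹ , (begin
      (x * y⁻¹) * (x * y⁻¹)
        ≡⟨ ≈⇒≡ (solve 2 (λ x i → (x :* i) :* (x :* i) := (x :* x) :* (i :* i)) ≈-refl x y⁻¹) ⟩
      (x * x) * (y⁻¹ * y⁻¹)         ≡⟨ cong (_* (y⁻¹ * y⁻¹)) xx≡cyy ⟩
      c * (y * y) * (y⁻¹ * y⁻¹)
        ≡⟨ ≈⇒≡ (solve 3 (λ c y i → c :* (y :* y) :* (i :* i) := c :* ((y :* i) :* (y :* i))) ≈-refl c y y⁻¹) ⟩
      c * ((y * y⁻¹) * (y * y⁻¹))   ≡⟨ cong (λ t → c * (t * t)) yy⁻¹≡1 ⟩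
      c * (1# * 1#)                 ≡⟨ ≈⇒≡ (≈-trans (*-congˡ (*-identityˡ 1#)) (*-identityʳ c)) ⟩
      c                             ∎)) c-nonsquare
    ... | yes refl = [ id , id ]′ (x*y≡0⇒x≡0⊎y≡0 xx≡0) , refl
      where
      xx≡0 : x * x ≡ 0#
      xx≡0 = trans xx≡cyy (≈⇒≡ (≈-trans (*-congˡ (zeroˡ 0#)) (zeroʳ c)))

module Graph (F : FiniteField) (λ' a : FiniteField.Carrier F)
             (λ'-nonsquare : ¬ IsSquare F λ') (a≢0 : a ≢ FiniteField.0# F) where
  open FiniteField F hiding (refl) renaming (sym to ≈-sym; trans to ≈-trans)
  open FieldProperties F
  private module +-Props = Algebra.Properties.CommutativeSemigroup +-commutativeSemigroup
  open ≡-Reasoning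

  infix 4 _⇢_
  _⇢_ : Carrier → Carrier → Set
  _⇢_ = Edge F λ' (linPoly F a)

  1+1≢0 : 1# + 1# ≢ 0#
  1+1≢0 = nonsquare⇒1+1≢0 λ'-nonsquare

  a+a≢0 : a + a ≢ 0#
  a+a≢0 = a≢0 ∘ x+x≡0⇒x≡0 1+1≢0

  λ'≢0 : λ' ≢ 0#
  λ'≢0 = nonsquare⇒≢0 λ'-nonsquare

  λ'≢1 : λ' ≢ 1#
  λ'≢1 = nonsquare⇒≢1 λ'-nonsquare

  inˢ inⁿ : Carrier → Carrier
  inˢ y = y * y - a
  inⁿ y = λ' * (y * y) - a

  inˢ+a≡y*y : ∀ y → inˢ y + a ≡ y * y
  inˢ+a≡y*y y = x-y+y≡x (y * y) a

  inⁿ+a≡λ'y*y : ∀ y → inⁿ y + a ≡ λ' * (y * y)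
  inⁿ+a≡λ'y*y y = x-y+y≡x (λ' * (y * y)) a

  inˢ-neg : ∀ y → inˢ (- y) ≡ inˢ y
  inˢ-neg y = cong (_- a) (-x*-x≡x*x y)

  inⁿ-neg : ∀ y → inⁿ (- y) ≡ inⁿ y
  inⁿ-neg y = cong (λ t → λ' * t - a) (-x*-x≡x*x y)

  ⇢-elim : ∀ {x y} → x ⇢ y → y * y ≡ x + a ⊎ λ' * (y * y) ≡ x + a
  ⇢-elim e with x*y≡0⇒x≡0⊎y≡0 e
  ... | inj₁ d≡0 = inj₁ (x-y≡0⇒x≡y d≡0)
  ... | inj₂ d≡0 = inj₂ (x-y≡0⇒x≡y d≡0)

  inˢ-⇢ : ∀ y → inˢ y ⇢ y
  inˢ-⇢ y = trans (cong (_* (λ' * (y * y) - (inˢ y + a))) (x≡y⇒x-y≡0 (sym (inˢ+a≡y*y y))))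
                  (≈⇒≡ (zeroˡ _))

  inⁿ-⇢ : ∀ y → inⁿ y ⇢ y
  inⁿ-⇢ y = trans (cong ((y * y - (inⁿ y + a)) *_) (x≡y⇒x-y≡0 (sym (inⁿ+a≡λ'y*y y))))
                  (≈⇒≡ (zeroʳ _))

  ⇢-neg : ∀ {x y} → x ⇢ y → x ⇢ - y
  ⇢-neg {x} e = subst (λ s → (s - (x + a)) * (λ' * s - (x + a)) ≡ 0#) (sym (-x*-x≡x*x _)) e

  ⇢-source : ∀ {x y} → x ⇢ y → x ≡ inˢ y ⊎ x ≡ inⁿ y
  ⇢-source = Sum.map (x+y≡z⇒x≡z-y ∘ sym) (x+y≡z⇒x≡z-y ∘ sym) ∘ ⇢-elim

  inˢ-out : ∀ {y z} → y ≢ 0# → inˢ y ⇢ z → z ≡± y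
  inˢ-out {y} y≢0 e with ⇢-elim e
  ... | inj₁ zz≡ = x*x≡y*y⇒x≡±y (trans zz≡ (inˢ+a≡y*y y))
  ... | inj₂ λ'zz≡ =
    contradiction (Product.proj₁ (x*x≡c[y*y]⇒x≡0×y≡0 λ'-nonsquare (sym (trans λ'zz≡ (inˢ+a≡y*y y))))) y≢0

  inⁿ-out : ∀ {y z} → y ≢ 0# → inⁿ y ⇢ z → z ≡± y
  inⁿ-out {y} y≢0 e with ⇢-elim e
  ... | inj₁ zz≡ =
    contradiction (Product.proj₂ (x*x≡c[y*y]⇒x≡0×y≡0 λ'-nonsquare (trans zz≡ (inⁿ+a≡λ'y*y y)))) y≢0
  ... | inj₂ λ'zz≡ = x*x≡y*y⇒x≡±y (*-cancelˡ-≢0 λ'≢0 (trans λ'zz≡ (inⁿ+a≡λ'y*y y)))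

  inˢ≢inⁿ : ∀ {y} → y ≢ 0# → inˢ y ≢ inⁿ y
  inˢ≢inⁿ {y} y≢0 inˢ≡inⁿ = y≢0 (Product.proj₁ (x*x≡c[y*y]⇒x≡0×y≡0 λ'-nonsquare (begin
    y * y         ≡⟨ sym (inˢ+a≡y*y y) ⟩
    inˢ y + a     ≡⟨ cong (_+ a) inˢ≡inⁿ ⟩
    inⁿ y + a     ≡⟨ inⁿ+a≡λ'y*y y ⟩
    λ' * (y * y)  ∎)))

  antipodal⇒sum≡a+a : ∀ {x y X Y} → x + a ≡ X → y + a ≡ Y → x ≡ - y → X + Y ≡ a + a
  antipodal⇒sum≡a+a {x} {y} refl refl x≡-y = begin
    (x + a) + (y + a)   ≡⟨ ≈⇒≡ (+-Props.interchange x a y a) ⟩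
    (x + y) + (a + a)   ≡⟨ cong (λ t → (t + y) + (a + a)) x≡-y ⟩
    (- y + y) + (a + a) ≡⟨ ≈⇒≡ (≈-trans (+-congʳ (-‿inverseˡ y)) (+-identityˡ (a + a))) ⟩
    a + a               ∎

  antipodal-in-neighbours : ∀ {y z} →
    (inˢ z ≡ - inˢ y × inⁿ z ≡ - inⁿ y) ⊎ (inˢ z ≡ - inⁿ y × inⁿ z ≡ - inˢ y) → z ≡± y
  antipodal-in-neighbours {y} {z} (inj₁ (s≡-s , n≡-n)) = contradiction λ'≡1 λ'≢1
    where
    λ'≡1 : λ' ≡ 1#
    λ'≡1 = *-cancelʳ-≢0 a+a≢0 (begin
      λ' * (a + a)                 ≡⟨ cong (λ' *_) (sym (antipodal⇒sum≡a+a (inˢ+a≡y*y z) (inˢ+a≡y*y y) s≡-s)) ⟩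
      λ' * (z * z + y * y)         ≡⟨ ≈⇒≡ (distribˡ λ' (z * z) (y * y)) ⟩
      λ' * (z * z) + λ' * (y * y)  ≡⟨ antipodal⇒sum≡a+a (inⁿ+a≡λ'y*y z) (inⁿ+a≡λ'y*y y) n≡-n ⟩
      a + a                        ≡⟨ ≈⇒≡ (≈-sym (*-identityˡ (a + a))) ⟩
      1# * (a + a)                 ∎)
  antipodal-in-neighbours {y} {z} (inj₂ (s≡-n , n≡-s)) =
    x*x≡y*y⇒x≡±y (x+cy≡cx+y⇒x≡y λ'≢1 (begin
    z * z + λ' * (y * y)  ≡⟨ antipodal⇒sum≡a+a (inˢ+a≡y*y z) (inⁿ+a≡λ'y*y y) s≡-n ⟩
    a + a                 ≡⟨ sym (antipodal⇒sum≡a+a (inⁿ+a≡λ'y*y z) (inˢ+a≡y*y y) n≡-s) ⟩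
    λ' * (z * z) + y * y  ∎))

  balanced-in-neighbours : ∀ {y z} → inⁿ y ≡ - inˢ y → inⁿ z ≡ - inˢ z → z ≡± y
  balanced-in-neighbours {y} {z} y-balanced z-balanced =
    x*x≡y*y⇒x≡±y (sym (x+cx≡y+cy⇒x≡y (a+a≢0 ∘ trans (sym (sum≡a+a y-balanced)))
                                     (trans (sum≡a+a y-balanced) (sym (sum≡a+a z-balanced)))))
    where
    sum≡a+a : ∀ {w} → inⁿ w ≡ - inˢ w → w * w + λ' * (w * w) ≡ a + a
    sum≡a+a {w} balanced = trans (≈⇒≡ (+-comm (w * w) (λ' * (w * w))))
                                 (antipodal⇒sum≡a+a (inⁿ+a≡λ'y*y w) (inˢ+a≡y*y w) balanced)

  inˢ0≡-a : inˢ 0# ≡ - a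
  inˢ0≡-a = ≈⇒≡ (≈-trans (+-congʳ (zeroˡ 0#)) (+-identityˡ (- a)))

  ≡±⇒inˢ≡ : ∀ {y z} → y ≡± z → inˢ y ≡ inˢ z
  ≡±⇒inˢ≡ (inj₁ refl) = refl
  ≡±⇒inˢ≡ (inj₂ refl) = inˢ-neg _

  ≡±⇒inⁿ≡ : ∀ {y z} → y ≡± z → inⁿ y ≡ inⁿ z
  ≡±⇒inⁿ≡ (inj₁ refl) = refl
  ≡±⇒inⁿ≡ (inj₂ refl) = inⁿ-neg _

module FourVertexComponent
  (F : FiniteField) (λ' a : FiniteField.Carrier F)
  (λ'-nonsquare : ¬ IsSquare F λ') (a≢0 : a ≢ FiniteField.0# F)
  (u : FiniteField.Carrier F) (vs : Vec (FiniteField.Carrier F) 4) (vs-unique : Unique vs)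
  (vs-connected : All (WConn F λ' (linPoly F a) u) vs)
  (vs-complete : ∀ {w} → WConn F λ' (linPoly F a) u w → w ∈ vs)
  where
  open FiniteField F hiding (refl; sym; trans)
  open FieldProperties F
  open Graph F λ' a λ'-nonsquare a≢0

  C : Carrier → Set
  C = WConn F λ' (linPoly F a) u

  C-source : ∀ {x y} → x ⇢ y → C y → C x
  C-source x⇢y Cy = Cy ◅◅ (bwd x⇢y ◅ ε)

  C-target : ∀ {x y} → x ⇢ y → C x → C y
  C-target x⇢y Cx = Cx ◅◅ (fwd x⇢y ◅ ε)

  C-inˢ : ∀ {y} → C y → C (inˢ y)
  C-inˢ = C-source (inˢ-⇢ _)

  C-inⁿ : ∀ {y} → C y → C (inⁿ y)
  C-inⁿ = C-source (inⁿ-⇢ _)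

  C-neg : ∀ {y} → C y → C (- y)
  C-neg Cy = C-target (⇢-neg (inˢ-⇢ _)) (C-inˢ Cy)

  exhaustive : ∀ {xs : Vec Carrier 4} → Unique xs → All C xs → ∀ {w} → C w → w ∈ xs
  exhaustive = unique⇒exhaustive _≟_ vs-complete

  0∉C : ¬ C 0#
  0∉C C0 = no-fifth (∃-outside _≟_ vs-unique vs-connected (0# ∷ a ∷ - a ∷ []) (n<1+n 3))
    where
    C-a : C (- a)
    C-a = subst C inˢ0≡-a (C-inˢ C0)

    Ca : C a
    Ca = subst C (-‿involutive a) (C-neg C-a)

    0±a-unique : Unique (0# ∷ a ∷ - a ∷ [])
    0±a-unique = (≢-sym a≢0 ∷ (a≢0 ∘ -x≡0⇒x≡0 ∘ sym) ∷ []) ∷ (x≢0⇒x≢-x 1+1≢0 a≢0 ∷ []) ∷ [] ∷ []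

    no-fifth : (∃ λ z → C z × All (z ≢_) (0# ∷ a ∷ - a ∷ [])) → ⊥
    no-fifth (z , Cz , z∉@(z≢0 ∷ z≢a ∷ z≢-a ∷ []))
      with exhaustive (z∉ ∷ 0±a-unique) (Cz ∷ C0 ∷ Ca ∷ C-a ∷ []) (C-neg Cz)
    ... | here -z≡z                          = x≢0⇒x≢-x 1+1≢0 z≢0 (sym -z≡z)
    ... | there (here -z≡0)                  = z≢0 (-x≡0⇒x≡0 -z≡0)
    ... | there (there (here -z≡a))          = z≢-a (x≡-y⇒y≡-x (sym -z≡a))
    ... | there (there (there (here -z≡-a))) = z≢a (-x≡-y⇒x≡y -z≡-a)

  C⇒≢0 : ∀ {w} → C w → w ≢ 0#
  C⇒≢0 Cw refl = 0∉C Cw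

  A B : Carrier
  A = inˢ u
  B = inⁿ u

  u≢0 : u ≢ 0#
  u≢0 = C⇒≢0 ε

  A≢B : A ≢ B
  A≢B = inˢ≢inⁿ u≢0

  in-neighbour-of-outsider : ∀ {p q x Y} → ¬ Y ≡± u → Unique (A ∷ B ∷ p ∷ q ∷ []) → C p → C q →
                             C x → x ⇢ Y → x ≡ p ⊎ x ≡ q
  in-neighbour-of-outsider {p} {q} Y≢±u xs-unique Cp Cq Cx x⇢Y
    with exhaustive xs-unique (C-inˢ ε ∷ C-inⁿ ε ∷ Cp ∷ Cq ∷ []) Cx
  ... | here refl                        = contradiction (inˢ-out u≢0 x⇢Y) Y≢±u
  ... | there (here refl)                = contradiction (inⁿ-out u≢0 x⇢Y) Y≢±u
  ... | there (there (here x≡p))         = inj₁ x≡p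
  ... | there (there (there (here x≡q))) = inj₂ x≡q

  in-neighbours-of-outsider : ∀ {p q Y} → ¬ Y ≡± u → Unique (A ∷ B ∷ p ∷ q ∷ []) → C p → C q → C Y →
                              (inˢ Y ≡ p × inⁿ Y ≡ q) ⊎ (inˢ Y ≡ q × inⁿ Y ≡ p)
  in-neighbours-of-outsider Y≢±u xs-unique Cp Cq CY = distinct-pair
    (in-neighbour-of-outsider Y≢±u xs-unique Cp Cq (C-inˢ CY) (inˢ-⇢ _))
    (in-neighbour-of-outsider Y≢±u xs-unique Cp Cq (C-inⁿ CY) (inⁿ-⇢ _))
    (inˢ≢inⁿ (C⇒≢0 CY))

  ≡±⇒∈± : ∀ {x} → x ≡± u → x ∈ u ∷ - u ∷ []
  ≡±⇒∈± = [ here , there ∘ here ]′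

  closed-case : B ≡ - A → A ≡± u → ⊥
  closed-case B≡-A A≡±u =
    contradiction (unique⊆⇒length≤ vs-unique (All.map (≡±⇒∈± ∘ C⇒≡±u) vs-connected)) (from-no (4 ≤? 2))
    where
    C⇒≡±u : ∀ {w} → C w → w ≡± u
    C⇒≡±u Cw = Star-SymClosure-invariant forward backward Cw (inj₁ refl)
      where
      forward : ∀ {x y} → x ⇢ y → x ≡± u → y ≡± u
      forward x⇢y x≡±u with ≡±-trans x≡±u (≡±-sym A≡±u)
      ... | inj₁ refl   = inˢ-out u≢0 x⇢y
      ... | inj₂ x≡-A   = inⁿ-out u≢0 (subst (_⇢ _) (trans x≡-A (sym B≡-A)) x⇢y)

      backward : ∀ {x y} → x ⇢ y → y ≡± u → x ≡± u
      backward x⇢y y≡±u with ⇢-source x⇢y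
      ... | inj₁ refl = subst (_≡± u) (sym (≡±⇒inˢ≡ y≡±u)) A≡±u
      ... | inj₂ refl = subst (_≡± u) (sym (≡±⇒inⁿ≡ y≡±u)) (≡±-trans (inj₂ B≡-A) A≡±u)

  balanced-case : B ≡ - A → ¬ A ≡± u → ⊥
  balanced-case B≡-A A≢±u = A≢±u (balanced-in-neighbours B≡-A A-balanced)
    where
    B≢±u : ¬ B ≡± u
    B≢±u B≡±u = A≢±u (≡±-trans (inj₂ (x≡-y⇒y≡-x B≡-A)) B≡±u)

    xs-unique : Unique (A ∷ B ∷ u ∷ - u ∷ [])
    xs-unique = (A≢B ∷ (A≢±u ∘ inj₁) ∷ (A≢±u ∘ inj₂) ∷ [])
              ∷ ((B≢±u ∘ inj₁) ∷ (B≢±u ∘ inj₂) ∷ [])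
              ∷ (x≢0⇒x≢-x 1+1≢0 u≢0 ∷ [])
              ∷ [] ∷ []

    A-balanced : inⁿ A ≡ - inˢ A
    A-balanced with in-neighbours-of-outsider A≢±u xs-unique ε (C-neg ε) (C-inˢ ε)
    ... | inj₁ (inˢA≡u , inⁿA≡-u) = trans inⁿA≡-u (cong -_ (sym inˢA≡u))
    ... | inj₂ (inˢA≡-u , inⁿA≡u) = trans inⁿA≡u (x≡-y⇒y≡-x inˢA≡-u)

  unbalanced-case : B ≢ - A → ⊥
  unbalanced-case B≢-A = no-outsider (outsider (u≡±A⊎u≡±B (exhaustive xs-unique Cxs ε)))
    where
    C-A : C (- A)
    C-A = C-neg (C-inˢ ε)

    C-B : C (- B)
    C-B = C-neg (C-inⁿ ε)

    Cxs : All C (A ∷ B ∷ - A ∷ - B ∷ [])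
    Cxs = C-inˢ ε ∷ C-inⁿ ε ∷ C-A ∷ C-B ∷ []

    xs-unique : Unique (A ∷ B ∷ - A ∷ - B ∷ [])
    xs-unique = (A≢B ∷ x≢0⇒x≢-x 1+1≢0 (C⇒≢0 (C-inˢ ε)) ∷ (B≢-A ∘ x≡-y⇒y≡-x) ∷ [])
              ∷ (B≢-A ∷ x≢0⇒x≢-x 1+1≢0 (C⇒≢0 (C-inⁿ ε)) ∷ [])
              ∷ ((A≢B ∘ -x≡-y⇒x≡y) ∷ [])
              ∷ [] ∷ []

    B≢±A : ¬ B ≡± A
    B≢±A = [ A≢B ∘ sym , B≢-A ]′

    u≡±A⊎u≡±B : u ∈ A ∷ B ∷ - A ∷ - B ∷ [] → u ≡± A ⊎ u ≡± B
    u≡±A⊎u≡±B (here u≡A)                          = inj₁ (inj₁ u≡A)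
    u≡±A⊎u≡±B (there (here u≡B))                   = inj₂ (inj₁ u≡B)
    u≡±A⊎u≡±B (there (there (here u≡-A)))          = inj₁ (inj₂ u≡-A)
    u≡±A⊎u≡±B (there (there (there (here u≡-B)))) = inj₂ (inj₂ u≡-B)

    outsider : u ≡± A ⊎ u ≡± B → ∃ λ Y → C Y × ¬ Y ≡± u
    outsider (inj₁ u≡±A) = B , C-inⁿ ε , B≢±A ∘ flip ≡±-trans u≡±A
    outsider (inj₂ u≡±B) = A , C-inˢ ε , B≢±A ∘ ≡±-sym ∘ flip ≡±-trans u≡±B

    no-outsider : (∃ λ Y → C Y × ¬ Y ≡± u) → ⊥
    no-outsider (Y , CY , Y≢±u) =
      Y≢±u (antipodal-in-neighbours (in-neighbours-of-outsider Y≢±u xs-unique C-A C-B CY))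

  impossible : ⊥
  impossible with B ≟ - A
  ... | no  B≢-A = unbalanced-case B≢-A
  ... | yes B≡-A with A ≟ u | A ≟ - u
  ...   | yes A≡u | _        = closed-case B≡-A (inj₁ A≡u)
  ...   | no  _   | yes A≡-u = closed-case B≡-A (inj₂ A≡-u)
  ...   | no  A≢u | no A≢-u  = balanced-case B≡-A [ A≢u , A≢-u ]′

proposition4p7 : (F : FiniteField) → (p k : ℕ) → Prime p → p ≢ 2 → 1 ≤ k →
    FiniteField.size F ≡ p ^ k →
    (λ' a : FiniteField.Carrier F) → ¬ IsSquare F λ' → a ≢ FiniteField.0# F →
    ¬ HasComponentOfSize4 F λ' (linPoly F a)
proposition4p7 F _ _ _ _ _ _ λ' a λ'-nonsquare a≢0
  (v₁ , v₂ , v₃ , v₄ , v₁≢v₂ , v₁≢v₃ , v₁≢v₄ , v₂≢v₃ , v₂≢v₄ , v₃≢v₄ , c₂ , c₃ , c₄ , complete) =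
  FourVertexComponent.impossible F λ' a λ'-nonsquare a≢0 v₁ (v₁ ∷ v₂ ∷ v₃ ∷ v₄ ∷ [])
    ((v₁≢v₂ ∷ v₁≢v₃ ∷ v₁≢v₄ ∷ []) ∷ (v₂≢v₃ ∷ v₂≢v₄ ∷ []) ∷ (v₃≢v₄ ∷ []) ∷ [] ∷ [])
    (ε ∷ c₂ ∷ c₃ ∷ c₄ ∷ [])
    (λ {w} w∈C → [ here , [ there ∘ here , [ there ∘ there ∘ here , there ∘ there ∘ there ∘ here ]′ ]′ ]′
                   (complete w w∈C))
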